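{- Let $\Gamma=(V,E)$ be a connected $G$-locally arc-transitive graph, $\{\alpha,\beta\}\in E$ and $N\trianglelefteq G$. Suppose that $\gcd(|N_\alpha|,|\Gamma(\alpha)|)=1=\gcd(|N_\beta|,|\Gamma(\beta)|)$. Then $N$ is semiregular on $V$.
   Context: Graphs are finite, simple, undirected; $G\leqslant\mathrm{Aut}(\Gamma)$. $\Gamma$ is $G$-locally arc-transitive if $G_\gamma$ is transitive on $\Gamma(\gamma)$ for every vertex $\gamma$. Semiregular means all point stabilizers are trivial. -}

module Defs where

open import Data.Nat using (ℕ; suc)
open import Data.Bool using (Bool; true; false)
open import Data.Fin using (Fin)
open import Data.Fin.Properties using (_≟_)
open import Data.Vec using (Vec; lookup; tabulate; allFin)
import Data.List as L
open import Data.List using (List; length; filter)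
open import Data.List.Membership.Propositional using (_∈_)
open import Data.List.Relation.Unary.Unique.Propositional using (Unique)
open import Data.Product using (Σ; _×_; _,_)
open import Relation.Binary.PropositionalEquality using (_≡_)
open import Function.Definitions using (Injective)
open import Relation.Nullary using (¬_)

record Graph (n : ℕ) : Set where
  field
    adj    : Fin n → Fin n → Bool
    symm   : ∀ x y → adj x y ≡ adj y x
    irrefl : ∀ x → adj x x ≡ false
open Graph public

Adj : ∀ {n} → Graph n → Fin n → Fin n → Set
Adj Γ x y = adj Γ x y ≡ true

nbhd : ∀ {n} → Graph n → Fin n → List (Fin n)
nbhd {n} Γ x = filter (λ y → Data.Bool._≟_ (adj Γ x y) true) (L.allFin n)
  where import Data.Bool

degree : ∀ {n} → Graph n → Fin n → ℕ
degree Γ x = length (nbhd Γ x)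

data Walk {n} (Γ : Graph n) : Fin n → Fin n → Set where
  here : ∀ {x} → Walk Γ x x
  step : ∀ {x y z} → Adj Γ x y → Walk Γ y z → Walk Γ x z

Connected : ∀ {n} → Graph n → Set
Connected {n} Γ = ∀ (x y : Fin n) → Walk Γ x y

-- Maps V → V encoded as vectors (σ x = lookup σ x); decidable equality.
Map : ℕ → Set
Map n = Vec (Fin n) n

app : ∀ {n} → Map n → Fin n → Fin n
app = lookup

idMap : ∀ {n} → Map n
idMap {n} = allFin n

_∘ₘ_ : ∀ {n} → Map n → Map n → Map n
σ ∘ₘ τ = tabulate (λ x → lookup σ (lookup τ x))

IsAut : ∀ {n} → Graph n → Map n → Set
IsAut Γ σ = Injective _≡_ _≡_ (app σ) × (∀ x y → adj Γ (app σ x) (app σ y) ≡ adj Γ x y)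

record IsPermGroup {n} (H : List (Map n)) : Set where
  field
    unique  : Unique H
    hasId   : idMap ∈ H
    closed  : ∀ {σ τ} → σ ∈ H → τ ∈ H → (σ ∘ₘ τ) ∈ H
    inverse : ∀ {σ} → σ ∈ H → Σ (Map n) λ τ → τ ∈ H × (σ ∘ₘ τ ≡ idMap) × (τ ∘ₘ σ ≡ idMap)

record IsAutGroup {n} (Γ : Graph n) (G : List (Map n)) : Set where
  field
    isGroup : IsPermGroup G
    auts    : ∀ {σ} → σ ∈ G → IsAut Γ σ

-- N ⊴ G  (N is a subgroup of G with g N g⁻¹ ⊆ N, i.e. g h = h' g for some h' ∈ N)
record IsNormalSubgroup {n} (N G : List (Map n)) : Set where
  field
    isGroup : IsPermGroup N
    sub     : ∀ {h} → h ∈ N → h ∈ G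
    normal  : ∀ {g h} → g ∈ G → h ∈ N → Σ (Map n) λ h' → h' ∈ N × (g ∘ₘ h ≡ h' ∘ₘ g)

stab : ∀ {n} → List (Map n) → Fin n → List (Map n)
stab H x = filter (λ σ → app σ x ≟ x) H

stabOrder : ∀ {n} → List (Map n) → Fin n → ℕ
stabOrder H x = length (stab H x)

LocallyArcTransitive : ∀ {n} → Graph n → List (Map n) → Set
LocallyArcTransitive {n} Γ G =
  ∀ (γ δ ε : Fin n) → Adj Γ γ δ → Adj Γ γ ε →
    Σ (Map n) λ g → g ∈ G × (app g γ ≡ γ) × (app g δ ≡ ε)

Semiregular : ∀ {n} → List (Map n) → Set
Semiregular {n} H = ∀ {h} → h ∈ H → ∀ (x : Fin n) → app h x ≡ x → h ≡ idMap

{-# OPTIONS --safe #-}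
-- Fix an edge {α, δ}. As N ⊴ G, the stabiliser G_α permutes the N_α-orbits on Γ(α), and
-- it is transitive on Γ(α), so these orbits all have one length m. Hence m divides |Γ(α)|,
-- and by orbit–stabiliser m divides |N_α|; coprimality forces m = 1, that is, N_α fixes
-- Γ(α) pointwise. The same holds at β, and by conjugation at every vertex, because
-- connectivity and local arc-transitivity make every vertex a G-image of α or of β.
-- Along walks, an element of N fixing one vertex then fixes all of them.

module Submission where

open import Defs
open import Data.Nat using (ℕ; suc; _+_; _*_; _≤_; _<_; z≤n)
open import Data.Nat.Properties using (+-suc; ≤-antisym; ≤-<-trans)
open import Data.Nat.Induction using (<-wellFounded)
open import Data.Nat.Divisibility using (_∣_; _∣0; ∣-refl; ∣m∣n⇒∣m+n; m∣m*n; ∣1⇒≡1)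
open import Data.Nat.GCD using (gcd; gcd-greatest)
open import Data.Bool using (true)
import Data.Bool as Bool
open import Data.Fin using (Fin)
open import Data.Fin.Properties using (_≟_)
open import Data.Vec using (tabulate)
import Data.Vec.Properties as Vec
open import Data.List using (List; []; _∷_; length; filter; map; allFin)
open import Data.List.Properties using (length-map; filter-notAll)
open import Data.List.Membership.Propositional using (_∈_; find; lose)
open import Data.List.Membership.Propositional.Properties using (∈-filter⁺; ∈-filter⁻; ∈-allFin; ∈-map⁻)
open import Data.List.Relation.Binary.Subset.Propositional using (_⊆_)
open import Data.List.Relation.Unary.Any as Any using (Any; here; there; any?)
import Data.List.Relation.Unary.All as All
open import Data.List.Relation.Unary.Unique.Propositional using (Unique; []; _∷_)
import Data.List.Relation.Unary.Unique.Propositional.Properties as Unique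
open import Data.Product using (Σ; _×_; _,_; proj₂)
open import Data.Sum using (_⊎_; inj₁; inj₂)
open import Data.Empty using (⊥-elim)
open import Function using (_on_)
open import Induction.WellFounded using (Acc; acc)
open import Level using (Level)
open import Relation.Binary using (Rel; IsEquivalence; Decidable; DecidableEquality)
import Relation.Binary.Construct.On as On
open import Relation.Binary.PropositionalEquality
  using (_≡_; refl; sym; trans; cong; cong₂; subst; module ≡-Reasoning)
open import Relation.Nullary using (yes; no; ¬_; ¬?)
open import Relation.Unary using (Pred) renaming (Decidable to Decidable₁)
open import Relation.Unary.Properties using (∁?)

open ≡-Reasoning

module _ {A : Set} {ℓ : Level} {P : Pred A ℓ} (P? : Decidable₁ P) where

  length-filter+filter-∁ : ∀ xs → length xs ≡ length (filter P? xs) + length (filter (∁? P?) xs)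
  length-filter+filter-∁ [] = refl
  length-filter+filter-∁ (x ∷ xs) with P? x
  ... | yes _ = cong suc (length-filter+filter-∁ xs)
  ... | no _  = trans (cong suc (length-filter+filter-∁ xs)) (sym (+-suc _ _))

  filter-filter-⊆ : ∀ {ℓ′} {Q : Pred A ℓ′} (Q? : Decidable₁ Q) xs → (∀ {x} → x ∈ xs → P x → Q x) →
                    filter P? (filter Q? xs) ≡ filter P? xs
  filter-filter-⊆ Q? [] _ = refl
  filter-filter-⊆ Q? (x ∷ xs) P⇒Q with ih ← filter-filter-⊆ Q? xs (λ x∈ → P⇒Q (there x∈)) | Q? x
  ... | yes _ with P? x
  ...   | yes _ = cong (x ∷_) ih
  ...   | no _  = ih
  filter-filter-⊆ Q? (x ∷ xs) P⇒Q | no ¬q with P? x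
  ...   | yes p = ⊥-elim (¬q (P⇒Q (here refl) p))
  ...   | no _  = ih

length≡1⇒≡ : ∀ {A : Set} {xs : List A} {x y} → length xs ≡ 1 → x ∈ xs → y ∈ xs → x ≡ y
length≡1⇒≡ {xs = _ ∷ []} _ (here refl) (here refl) = refl

module _ {A : Set} (_≟ₐ_ : DecidableEquality A) where

  unique-⊆⇒length≤ : ∀ {xs ys : List A} → Unique xs → xs ⊆ ys → length xs ≤ length ys
  unique-⊆⇒length≤ {[]} _ _ = z≤n
  unique-⊆⇒length≤ {x ∷ xs} {ys} (x∉xs ∷ xs!) xs⊆ys =
    ≤-<-trans (unique-⊆⇒length≤ xs! xs⊆others)
              (filter-notAll other? ys (Any.map (λ x≡y x≢y → x≢y x≡y) (xs⊆ys (here refl))))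
    where
    other? : Decidable₁ (λ y → ¬ x ≡ y)
    other? y = ¬? (x ≟ₐ y)
    xs⊆others : xs ⊆ filter other? ys
    xs⊆others z∈ = ∈-filter⁺ other? (xs⊆ys (there z∈)) (All.lookup x∉xs z∈)

  injection⇒length≤ : ∀ {B : Set} {f : B → A} {xs ys} → Unique xs → (∀ {x y} → f x ≡ f y → x ≡ y) →
                      (∀ {x} → x ∈ xs → f x ∈ ys) → length xs ≤ length ys
  injection⇒length≤ {f = f} {xs} xs! f-injective into =
    subst (_≤ _) (length-map f xs) (unique-⊆⇒length≤ (Unique.map⁺ f-injective xs!) image⊆)
    where
    image⊆ : map f xs ⊆ _
    image⊆ y∈ with _ , x∈ , refl ← ∈-map⁻ f y∈ = into x∈

module _ {A : Set} {r : Level} {R : Rel A r} (R? : Decidable R) (R-equiv : IsEquivalence R) where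
  private module R = IsEquivalence R-equiv

  equal-classes⇒∣length : ∀ m xs → (∀ {x} → x ∈ xs → length (filter (R? x) xs) ≡ m) → m ∣ length xs
  equal-classes⇒∣length m xs = go xs (On.wellFounded length <-wellFounded xs)
    where
    go : ∀ xs → Acc (_<_ on length) xs → (∀ {x} → x ∈ xs → length (filter (R? x) xs) ≡ m) → m ∣ length xs
    go [] _ _ = m ∣0
    go (x ∷ xs) (acc rec) sizes =
      subst (m ∣_) (sym split) (∣m∣n⇒∣m+n ∣-refl (go rest (rec shorter) rest-sizes))
      where
      unrelated? = ∁? (R? x)
      rest = filter unrelated? (x ∷ xs)
      split : length (x ∷ xs) ≡ m + length rest
      split = trans (length-filter+filter-∁ (R? x) (x ∷ xs)) (cong (_+ length rest) (sizes (here refl)))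
      shorter : length rest < length (x ∷ xs)
      shorter = filter-notAll unrelated? (x ∷ xs) (here (λ ¬Rxx → ¬Rxx R.refl))
      rest-sizes : ∀ {y} → y ∈ rest → length (filter (R? y) rest) ≡ m
      rest-sizes {y} y∈ with y∈xs , ¬Rxy ← ∈-filter⁻ unrelated? y∈ =
        trans (cong length (filter-filter-⊆ (R? y) unrelated? (x ∷ xs) λ _ Ryz Rxz →
                 ¬Rxy (R.trans Rxz (R.sym Ryz))))
              (sizes y∈xs)

module _ {A B : Set} (_≟ₐ_ : DecidableEquality A) (φ : B → A) where

  fibre : A → List B → List B
  fibre y = filter (λ b → φ b ≟ₐ y)

  equal-fibres⇒length≡ : ∀ c {ys} bs → Unique ys → (∀ {b} → b ∈ bs → φ b ∈ ys) →
                         (∀ {y} → y ∈ ys → length (fibre y bs) ≡ c) → length bs ≡ length ys * c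
  equal-fibres⇒length≡ c {[]} [] _ _ _ = refl
  equal-fibres⇒length≡ c {[]} (b ∷ bs) _ into _ with () ← into (here refl)
  equal-fibres⇒length≡ c {y ∷ ys} bs (y∉ys ∷ ys!) into sizes = begin
    length bs                         ≡⟨ length-filter+filter-∁ (λ b → φ b ≟ₐ y) bs ⟩
    length (fibre y bs) + length rest ≡⟨ cong₂ _+_ (sizes (here refl)) rest-length ⟩
    c + length ys * c                 ∎
    where
    off? = ∁? (λ b → φ b ≟ₐ y)
    rest = filter off? bs
    rest-into : ∀ {b} → b ∈ rest → φ b ∈ ys
    rest-into b∈ with b∈bs , φb≢y ← ∈-filter⁻ off? b∈ with into b∈bs
    ... | here φb≡y = ⊥-elim (φb≢y φb≡y)
    ... | there φb∈ys = φb∈ys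
    rest-sizes : ∀ {y′} → y′ ∈ ys → length (fibre y′ rest) ≡ c
    rest-sizes y′∈ = trans (cong length (filter-filter-⊆ (λ b → φ b ≟ₐ _) off? bs
                             (λ _ φb≡y′ φb≡y → All.lookup y∉ys y′∈ (trans (sym φb≡y) φb≡y′))))
                           (sizes (there y′∈))
    rest-length : length rest ≡ length ys * c
    rest-length = equal-fibres⇒length≡ c rest ys! rest-into rest-sizes

module _ {n : ℕ} where

  app-∘ₘ : ∀ (σ τ : Map n) x → app (σ ∘ₘ τ) x ≡ app σ (app τ x)
  app-∘ₘ σ τ x = Vec.lookup∘tabulate _ x

  app-idMap : ∀ x → app (idMap {n}) x ≡ x
  app-idMap = Vec.lookup-allFin

  Map-ext : ∀ {σ τ : Map n} → (∀ x → app σ x ≡ app τ x) → σ ≡ τ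
  Map-ext {σ} {τ} σ≗τ = begin
    σ                ≡⟨ Vec.tabulate∘lookup σ ⟨
    tabulate (app σ) ≡⟨ Vec.tabulate-cong σ≗τ ⟩
    tabulate (app τ) ≡⟨ Vec.tabulate∘lookup τ ⟩
    τ                ∎

  _≟ₘ_ : DecidableEquality (Map n)
  _≟ₘ_ = Vec.≡-dec _≟_

  app-inverse : ∀ {σ τ : Map n} → τ ∘ₘ σ ≡ idMap → ∀ {a b} → app σ a ≡ b → app τ b ≡ a
  app-inverse {σ} {τ} τσ≡id {a} refl = begin
    app τ (app σ a) ≡⟨ app-∘ₘ τ σ a ⟨
    app (τ ∘ₘ σ) a  ≡⟨ cong (λ ρ → app ρ a) τσ≡id ⟩
    app idMap a     ≡⟨ app-idMap a ⟩
    a               ∎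

  ∈-stab⁺ : ∀ {H : List (Map n)} {h x} → h ∈ H → app h x ≡ x → h ∈ stab H x
  ∈-stab⁺ {x = x} = ∈-filter⁺ (λ σ → app σ x ≟ x)

  ∈-stab⁻ : ∀ {H : List (Map n)} {h x} → h ∈ stab H x → h ∈ H × app h x ≡ x
  ∈-stab⁻ {x = x} = ∈-filter⁻ (λ σ → app σ x ≟ x)

SameOrbit : ∀ {n} → List (Map n) → Rel (Fin n) _
SameOrbit H a b = Any (λ h → app h a ≡ b) H

sameOrbit? : ∀ {n} (H : List (Map n)) → Decidable (SameOrbit H)
sameOrbit? H a b = any? (λ h → app h a ≟ b) H

module PermGroup {n} {H : List (Map n)} (H-group : IsPermGroup H) where
  open IsPermGroup H-group

  app-injective : ∀ {h} → h ∈ H → ∀ {x y} → app h x ≡ app h y → x ≡ y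
  app-injective {h} h∈ hx≡hy with h′ , _ , _ , h′h≡id ← inverse h∈ =
    trans (sym (app-inverse {σ = h} {τ = h′} h′h≡id refl))
          (app-inverse {σ = h} {τ = h′} h′h≡id (sym hx≡hy))

  ∘ₘ-cancelˡ : ∀ {h} → h ∈ H → ∀ {σ τ} → h ∘ₘ σ ≡ h ∘ₘ τ → σ ≡ τ
  ∘ₘ-cancelˡ {h} h∈ {σ} {τ} hσ≡hτ = Map-ext λ x → app-injective h∈ (begin
    app h (app σ x) ≡⟨ app-∘ₘ h σ x ⟨
    app (h ∘ₘ σ) x  ≡⟨ cong (λ ρ → app ρ x) hσ≡hτ ⟩
    app (h ∘ₘ τ) x  ≡⟨ app-∘ₘ h τ x ⟩
    app h (app τ x) ∎)

  stab-isPermGroup : ∀ x → IsPermGroup (stab H x)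
  stab-isPermGroup x = record
    { unique  = Unique.filter⁺ (λ σ → app σ x ≟ x) unique
    ; hasId   = ∈-stab⁺ hasId (app-idMap x)
    ; closed  = stab-closed
    ; inverse = stab-inverse
    }
    where
    stab-closed : ∀ {σ τ} → σ ∈ stab H x → τ ∈ stab H x → σ ∘ₘ τ ∈ stab H x
    stab-closed {σ} {τ} σ∈ τ∈ with σ∈H , σx≡x ← ∈-stab⁻ σ∈ | τ∈H , τx≡x ← ∈-stab⁻ τ∈ =
      ∈-stab⁺ (closed σ∈H τ∈H) (trans (app-∘ₘ σ τ x) (trans (cong (app σ) τx≡x) σx≡x))
    stab-inverse : ∀ {σ} → σ ∈ stab H x →
                   Σ (Map n) λ τ → τ ∈ stab H x × (σ ∘ₘ τ ≡ idMap) × (τ ∘ₘ σ ≡ idMap)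
    stab-inverse {σ} σ∈ with σ∈H , σx≡x ← ∈-stab⁻ σ∈
                        with τ , τ∈H , στ≡id , τσ≡id ← inverse σ∈H =
      τ , ∈-stab⁺ τ∈H (app-inverse {σ = σ} {τ = τ} τσ≡id σx≡x) , στ≡id , τσ≡id

  sameOrbit-isEquivalence : IsEquivalence (SameOrbit H)
  sameOrbit-isEquivalence = record
    { refl  = lose hasId (app-idMap _)
    ; sym   = sameOrbit-sym
    ; trans = sameOrbit-trans
    }
    where
    sameOrbit-sym : ∀ {a b} → SameOrbit H a b → SameOrbit H b a
    sameOrbit-sym ha≡b with h , h∈ , ha≡b ← find ha≡b
                       with h′ , h′∈ , _ , h′h≡id ← inverse h∈ =
      lose h′∈ (app-inverse {σ = h} {τ = h′} h′h≡id ha≡b)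
    sameOrbit-trans : ∀ {a b c} → SameOrbit H a b → SameOrbit H b c → SameOrbit H a c
    sameOrbit-trans {a} ha≡b h′b≡c with h , h∈ , ha≡b ← find ha≡b
                                   with h′ , h′∈ , h′b≡c ← find h′b≡c =
      lose (closed h′∈ h∈) (trans (app-∘ₘ h′ h a) (trans (cong (app h′) ha≡b) h′b≡c))

  module _ (δ : Fin n) where
    private
      fibreOf : Fin n → List (Map n)
      fibreOf y = fibre _≟_ (λ h → app h δ) y H

    fibre-length-≤ : ∀ {h₀ a b} → h₀ ∈ H → app h₀ a ≡ b → length (fibreOf a) ≤ length (fibreOf b)
    fibre-length-≤ {h₀} {a} {b} h₀∈ h₀a≡b =
      injection⇒length≤ _≟ₘ_ (Unique.filter⁺ (λ h → app h δ ≟ a) unique) (∘ₘ-cancelˡ h₀∈) into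
      where
      into : ∀ {h} → h ∈ fibreOf a → h₀ ∘ₘ h ∈ fibreOf b
      into {h} h∈ with h∈H , hδ≡a ← ∈-filter⁻ (λ h → app h δ ≟ a) h∈ =
        ∈-filter⁺ _ (closed h₀∈ h∈H) (trans (app-∘ₘ h₀ h δ) (trans (cong (app h₀) hδ≡a) h₀a≡b))

    orbit-stabilizer : ∀ {ys} → Unique ys → (∀ {y} → y ∈ ys → SameOrbit H δ y) →
                       (∀ {h} → h ∈ H → app h δ ∈ ys) → length H ≡ length ys * stabOrder H δ
    orbit-stabilizer {ys} ys! ys⊆orbit orbit⊆ys =
      equal-fibres⇒length≡ _≟_ (λ h → app h δ) (stabOrder H δ) H ys! orbit⊆ys fibre-length
      where
      fibre-length : ∀ {y} → y ∈ ys → length (fibreOf y) ≡ stabOrder H δ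
      fibre-length y∈ with h₀ , h₀∈ , h₀δ≡y ← find (ys⊆orbit y∈)
                      with h₁ , h₁∈ , _ , h₁h₀≡id ← inverse h₀∈ =
        ≤-antisym (fibre-length-≤ h₁∈ (app-inverse {σ = h₀} {τ = h₁} h₁h₀≡id h₀δ≡y))
                  (fibre-length-≤ h₀∈ h₀δ≡y)

module _ {n} (Γ : Graph n) where

  adj-sym : ∀ {x y} → Adj Γ x y → Adj Γ y x
  adj-sym {x} {y} x~y = trans (symm Γ y x) x~y

  ∈-nbhd⁺ : ∀ {x y} → Adj Γ x y → y ∈ nbhd Γ x
  ∈-nbhd⁺ {x} {y} = ∈-filter⁺ (λ z → adj Γ x z Bool.≟ true) (∈-allFin y)

  ∈-nbhd⁻ : ∀ {x y} → y ∈ nbhd Γ x → Adj Γ x y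
  ∈-nbhd⁻ {x} y∈ = proj₂ (∈-filter⁻ (λ z → adj Γ x z Bool.≟ true) {xs = allFin n} y∈)

  nbhd-unique : ∀ x → Unique (nbhd Γ x)
  nbhd-unique x = Unique.filter⁺ (λ z → adj Γ x z Bool.≟ true) (Unique.allFin⁺ n)

module AutGroup {n} {Γ : Graph n} {G : List (Map n)} (Γ-aut : IsAutGroup Γ G) where
  open IsAutGroup Γ-aut
  open IsPermGroup isGroup

  adj-preserved : ∀ {g x y} → g ∈ G → Adj Γ x y → Adj Γ (app g x) (app g y)
  adj-preserved {g} {x} {y} g∈ x~y = trans (proj₂ (auts g∈) x y) x~y

  module _ (lat : LocallyArcTransitive Γ G) where

    neighbour-image : ∀ {u w g x y} → Adj Γ u w → g ∈ G → app g u ≡ x → Adj Γ x y →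
                      Σ (Map n) λ h → h ∈ G × app h w ≡ y
    neighbour-image {u} {w} {g} {x} {y} u~w g∈ gu≡x x~y
      with g′ , g′∈ , gg′≡id , g′g≡id ← inverse g∈
      with g′x≡u ← app-inverse {σ = g} {τ = g′} g′g≡id gu≡x
      with u~g′y ← subst (λ v → Adj Γ v (app g′ y)) g′x≡u (adj-preserved g′∈ x~y)
      with h , h∈ , _ , hw≡g′y ← lat u w (app g′ y) u~w u~g′y =
      g ∘ₘ h , closed g∈ h∈ , (begin
        app (g ∘ₘ h) w   ≡⟨ app-∘ₘ g h w ⟩
        app g (app h w)  ≡⟨ cong (app g) hw≡g′y ⟩
        app g (app g′ y) ≡⟨ app-inverse {σ = g′} {τ = g} gg′≡id refl ⟩
        y                ∎)

    module _ {α β : Fin n} (α~β : Adj Γ α β) where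

      VertexImage : Fin n → Set
      VertexImage γ = Σ (Map n) λ g → g ∈ G × (app g α ≡ γ ⊎ app g β ≡ γ)

      vertexImage-adj : ∀ {x y} → VertexImage x → Adj Γ x y → VertexImage y
      vertexImage-adj (g , g∈ , inj₁ gα≡x) x~y
        with h , h∈ , hβ≡y ← neighbour-image α~β g∈ gα≡x x~y = h , h∈ , inj₂ hβ≡y
      vertexImage-adj (g , g∈ , inj₂ gβ≡x) x~y
        with h , h∈ , hα≡y ← neighbour-image (adj-sym Γ α~β) g∈ gβ≡x x~y = h , h∈ , inj₁ hα≡y

      vertex-image : Connected Γ → ∀ γ → VertexImage γ
      vertex-image connected γ = along (idMap , hasId , inj₁ (app-idMap α)) (connected α γ)
        where
        along : ∀ {x y} → VertexImage x → Walk Γ x y → VertexImage y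
        along x-image here = x-image
        along x-image (step x~y walk) = along (vertexImage-adj x-image x~y) walk

module NormalSubgroup {n} {Γ : Graph n} {G N : List (Map n)}
                      (Γ-aut : IsAutGroup Γ G) (N⊴G : IsNormalSubgroup N G) where
  open IsNormalSubgroup N⊴G
  open AutGroup Γ-aut using (adj-preserved)
  private
    module G where
      open IsPermGroup (IsAutGroup.isGroup Γ-aut) public
      open PermGroup (IsAutGroup.isGroup Γ-aut) public
    module N = PermGroup isGroup

  conjugate : ∀ {g k} → g ∈ G → k ∈ N →
              Σ (Map n) λ k′ → k′ ∈ N × (∀ x → app k′ (app g x) ≡ app g (app k x))
  conjugate {g} {k} g∈ k∈ with k′ , k′∈ , gk≡k′g ← normal g∈ k∈ = k′ , k′∈ , λ x → begin
    app k′ (app g x) ≡⟨ app-∘ₘ k′ g x ⟨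
    app (k′ ∘ₘ g) x  ≡⟨ cong (λ ρ → app ρ x) gk≡k′g ⟨
    app (g ∘ₘ k) x   ≡⟨ app-∘ₘ g k x ⟩
    app g (app k x)  ∎

  NeighbourhoodFixed : Fin n → Set
  NeighbourhoodFixed v = ∀ {k} → k ∈ N → app k v ≡ v → ∀ {δ} → Adj Γ v δ → app k δ ≡ δ

  neighbourhoodFixed-transport : ∀ {g v γ} → g ∈ G → app g v ≡ γ →
                                 NeighbourhoodFixed v → NeighbourhoodFixed γ
  neighbourhoodFixed-transport {g} {v} {γ} g∈ gv≡γ v-fixed {k} k∈ kγ≡γ {δ} γ~δ
    with g′ , g′∈ , _ , g′g≡id ← G.inverse g∈
    with g′γ≡v ← app-inverse {σ = g} {τ = g′} g′g≡id gv≡γ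
    with k′ , k′∈ , k′g′≡g′k ← conjugate g′∈ k∈ =
    G.app-injective g′∈ (trans (sym (k′g′≡g′k δ)) (v-fixed k′∈ k′v≡v v~g′δ))
    where
    k′v≡v : app k′ v ≡ v
    k′v≡v = begin
      app k′ v         ≡⟨ cong (app k′) g′γ≡v ⟨
      app k′ (app g′ γ) ≡⟨ k′g′≡g′k γ ⟩
      app g′ (app k γ) ≡⟨ cong (app g′) kγ≡γ ⟩
      app g′ γ         ≡⟨ g′γ≡v ⟩
      v                ∎
    v~g′δ : Adj Γ v (app g′ δ)
    v~g′δ = subst (λ u → Adj Γ u (app g′ δ)) g′γ≡v (adj-preserved g′∈ γ~δ)

  neighbourhoodFixed⇒semiregular : Connected Γ → (∀ γ → NeighbourhoodFixed γ) → Semiregular N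
  neighbourhoodFixed⇒semiregular connected fixed {h} h∈ x hx≡x =
    Map-ext λ y → trans (along hx≡x (connected x y)) (sym (app-idMap y))
    where
    along : ∀ {a b} → app h a ≡ a → Walk Γ a b → app h b ≡ b
    along ha≡a here = ha≡a
    along ha≡a (step a~c walk) = along (fixed _ h∈ ha≡a a~c) walk

  module StabiliserOrbits (α : Fin n) where
    Nα : List (Map n)
    Nα = stab N α

    Nα-group : IsPermGroup Nα
    Nα-group = N.stab-isPermGroup α

    Nα-sameOrbit : IsEquivalence (SameOrbit Nα)
    Nα-sameOrbit = PermGroup.sameOrbit-isEquivalence Nα-group

    localOrbit : Fin n → List (Fin n)
    localOrbit δ = filter (sameOrbit? Nα δ) (nbhd Γ α)

    localOrbit-unique : ∀ δ → Unique (localOrbit δ)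
    localOrbit-unique δ = Unique.filter⁺ (sameOrbit? Nα δ) (nbhd-unique Γ α)

    ∈-localOrbit : ∀ {δ k} → Adj Γ α δ → k ∈ Nα → app k δ ∈ localOrbit δ
    ∈-localOrbit {δ} {k} α~δ k∈ with k∈N , kα≡α ← ∈-stab⁻ k∈ =
      ∈-filter⁺ (sameOrbit? Nα δ) (∈-nbhd⁺ Γ α~kδ) (lose k∈ refl)
      where
      α~kδ : Adj Γ α (app k δ)
      α~kδ = subst (λ u → Adj Γ u (app k δ)) kα≡α (adj-preserved (sub k∈N) α~δ)

    localOrbit-length∣stabOrder : ∀ {δ} → Adj Γ α δ → length (localOrbit δ) ∣ stabOrder N α
    localOrbit-length∣stabOrder {δ} α~δ =
      subst (length (localOrbit δ) ∣_) (sym |Nα|≡) (m∣m*n (stabOrder Nα δ))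
      where
      |Nα|≡ : length Nα ≡ length (localOrbit δ) * stabOrder Nα δ
      |Nα|≡ = PermGroup.orbit-stabilizer Nα-group δ
                (localOrbit-unique δ)
                (λ y∈ → proj₂ (∈-filter⁻ (sameOrbit? Nα δ) {xs = nbhd Γ α} y∈))
                (∈-localOrbit α~δ)

    localOrbit-length-≤ : LocallyArcTransitive Γ G → ∀ {δ ε} → Adj Γ α δ → Adj Γ α ε →
                          length (localOrbit δ) ≤ length (localOrbit ε)
    localOrbit-length-≤ lat {δ} {ε} α~δ α~ε with g , g∈ , gα≡α , gδ≡ε ← lat α δ ε α~δ α~ε =
      injection⇒length≤ _≟_ (localOrbit-unique δ) (G.app-injective g∈) into
      where
      into : ∀ {ζ} → ζ ∈ localOrbit δ → app g ζ ∈ localOrbit ε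
      into {ζ} ζ∈ with ζ∈Γα , δ∼ζ ← ∈-filter⁻ (sameOrbit? Nα δ) {xs = nbhd Γ α} ζ∈
                  with k , k∈ , kδ≡ζ ← find δ∼ζ
                  with k∈N , kα≡α ← ∈-stab⁻ k∈
                  with k′ , k′∈N , k′g≡gk ← conjugate g∈ k∈N =
        ∈-filter⁺ (sameOrbit? Nα ε) (∈-nbhd⁺ Γ α~gζ) (lose (∈-stab⁺ k′∈N k′α≡α) k′ε≡gζ)
        where
        k′α≡α : app k′ α ≡ α
        k′α≡α = begin
          app k′ α         ≡⟨ cong (app k′) gα≡α ⟨
          app k′ (app g α) ≡⟨ k′g≡gk α ⟩
          app g (app k α)  ≡⟨ cong (app g) kα≡α ⟩
          app g α          ≡⟨ gα≡α ⟩
          α                ∎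
        k′ε≡gζ : app k′ ε ≡ app g ζ
        k′ε≡gζ = begin
          app k′ ε         ≡⟨ cong (app k′) gδ≡ε ⟨
          app k′ (app g δ) ≡⟨ k′g≡gk δ ⟩
          app g (app k δ)  ≡⟨ cong (app g) kδ≡ζ ⟩
          app g ζ          ∎
        α~gζ : Adj Γ α (app g ζ)
        α~gζ = subst (λ u → Adj Γ u (app g ζ)) gα≡α (adj-preserved g∈ (∈-nbhd⁻ Γ ζ∈Γα))

    localOrbit-length∣degree : LocallyArcTransitive Γ G → ∀ {δ} → Adj Γ α δ →
                               length (localOrbit δ) ∣ degree Γ α
    localOrbit-length∣degree lat {δ} α~δ =
      equal-classes⇒∣length (sameOrbit? Nα) Nα-sameOrbit (length (localOrbit δ)) (nbhd Γ α) λ ε∈ →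
        ≤-antisym (localOrbit-length-≤ lat (∈-nbhd⁻ Γ ε∈) α~δ)
                  (localOrbit-length-≤ lat α~δ (∈-nbhd⁻ Γ ε∈))

  coprime⇒neighbourhoodFixed : LocallyArcTransitive Γ G → ∀ α → gcd (stabOrder N α) (degree Γ α) ≡ 1 →
                               NeighbourhoodFixed α
  coprime⇒neighbourhoodFixed lat α coprime k∈ kα≡α {δ} α~δ =
    length≡1⇒≡ orbit-trivial (∈-localOrbit α~δ (∈-stab⁺ k∈ kα≡α)) δ∈localOrbit
    where
    open StabiliserOrbits α
    orbit-trivial : length (localOrbit δ) ≡ 1
    orbit-trivial = ∣1⇒≡1 (subst (length (localOrbit δ) ∣_) coprime
      (gcd-greatest (localOrbit-length∣stabOrder α~δ) (localOrbit-length∣degree lat α~δ)))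
    δ∈localOrbit : δ ∈ localOrbit δ
    δ∈localOrbit = ∈-filter⁺ (sameOrbit? Nα δ) (∈-nbhd⁺ Γ α~δ) (IsEquivalence.refl Nα-sameOrbit)

lemma2p4 : (n : ℕ) (Γ : Graph n) (G N : List (Map n)) →
    IsAutGroup Γ G → Connected Γ → LocallyArcTransitive Γ G →
    (α β : Fin n) → Adj Γ α β → IsNormalSubgroup N G →
    gcd (stabOrder N α) (degree Γ α) ≡ 1 →
    gcd (stabOrder N β) (degree Γ β) ≡ 1 →
    Semiregular N
lemma2p4 n Γ G N Γ-aut connected lat α β α~β N⊴G coprime-α coprime-β =
  neighbourhoodFixed⇒semiregular connected everywhere
  where
  open AutGroup Γ-aut using (vertex-image)
  open NormalSubgroup Γ-aut N⊴G
  α-fixed : NeighbourhoodFixed α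
  α-fixed = coprime⇒neighbourhoodFixed lat α coprime-α
  β-fixed : NeighbourhoodFixed β
  β-fixed = coprime⇒neighbourhoodFixed lat β coprime-β
  everywhere : ∀ γ → NeighbourhoodFixed γ
  everywhere γ with vertex-image lat α~β connected γ
  ... | g , g∈ , inj₁ gα≡γ = neighbourhoodFixed-transport g∈ gα≡γ α-fixed
  ... | g , g∈ , inj₂ gβ≡γ = neighbourhoodFixed-transport g∈ gβ≡γ β-fixed
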